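{- Let $\mathcal{L}$ be a finite trim lattice with left modular labelling $\gamma$. Then $\{\mathrm{D}^\gamma(x): x\in\mathcal{L}\}=\{\mathrm{U}^\gamma(x): x\in\mathcal{L}\}$, and this family $\gamma(\mathcal{L})$ of subsets of $[n]$ is a simplicial complex: for every $x\in\mathcal{L}$ and every subset $B\subseteq\mathrm{D}^\gamma(x)$ there exists $y\in\mathcal{L}$ with $\mathrm{D}^\gamma(y)=B$.
   Context: A finite lattice of length $n$ is extremal if it has exactly $n$ join-irreducible and $n$ meet-irreducible elements; an element $x$ is left modular if $(y\vee x)\wedge z=y\vee(x\wedge z)$ for all $y\le z$; the lattice is trim if it is extremal and has a maximal chain of left modular elements. For a fixed chain $\hat0=x_0\lessdot\dots\lessdot x_n=\hat1$ of left modular elements of length $n$, the left modular labelling is $\gamma(y\lessdot z)=\min\{i\in[n]: y\vee(x_i\wedge z)=z\}$; $\mathrm{D}^\gamma(y)=\{\gamma(x\lessdot y): x\lessdot y\}$ and $\mathrm{U}^\gamma(y)=\{\gamma(y\lessdot z): y\lessdot z\}$. -}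

module Defs where

open import Level using (0ℓ)
open import Data.Nat using (ℕ; suc) renaming (_≤_ to _≤ℕ_)
open import Data.Fin using (Fin; zero; suc; inject₁; fromℕ; _<_)
open import Data.Fin.Subset using (Subset; _∈_)
open import Data.Product using (Σ; ∃; _×_)
open import Relation.Binary using (Rel)
open import Relation.Binary.PropositionalEquality using (_≡_; _≢_)
open import Relation.Binary.Lattice.Structures using (IsLattice)
open import Function.Definitions using (Injective)
open import Function.Bundles using (_⇔_)
open import Relation.Nullary using (¬_)

record FiniteLattice : Set₁ where
  field
    m         : ℕ
    _≤_       : Rel (Fin m) 0ℓ
    _∨_       : Fin m → Fin m → Fin m
    _∧_       : Fin m → Fin m → Fin m
    isLattice : IsLattice _≡_ _≤_ _∨_ _∧_

  infix 4 _≤_ _<ₗ_ _⋖_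
  infixr 6 _∨_
  infixr 7 _∧_

  Elem : Set
  Elem = Fin m

  _<ₗ_ : Elem → Elem → Set
  x <ₗ y = (x ≤ y) × (x ≢ y)

  _⋖_ : Elem → Elem → Set
  x ⋖ y = (x <ₗ y) × (∀ w → ¬ ((x <ₗ w) × (w <ₗ y)))

  IsBottom : Elem → Set
  IsBottom b = ∀ y → b ≤ y

  IsTop : Elem → Set
  IsTop t = ∀ y → y ≤ t

  IsChain : (k : ℕ) → (Fin (suc k) → Elem) → Set
  IsChain k c = ∀ (i : Fin k) → c (inject₁ i) <ₗ c (suc i)

  HasLength : ℕ → Set
  HasLength n = (Σ (Fin (suc n) → Elem) (IsChain n))
              × (∀ k (c : Fin (suc k) → Elem) → IsChain k c → k ≤ℕ n)

  JoinIrreducible : Elem → Set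
  JoinIrreducible x = (¬ IsBottom x) × (∀ y z → x ≡ y ∨ z → (x ≡ y) ⊎' (x ≡ z))
    where open import Data.Sum renaming (_⊎_ to _⊎'_)

  MeetIrreducible : Elem → Set
  MeetIrreducible x = (¬ IsTop x) × (∀ y z → x ≡ y ∧ z → (x ≡ y) ⊎' (x ≡ z))
    where open import Data.Sum renaming (_⊎_ to _⊎'_)

  HasExactly : ℕ → (Elem → Set) → Set
  HasExactly k P = Σ (Fin k → Elem) λ f →
    Injective _≡_ _≡_ f × (∀ i → P (f i)) × (∀ x → P x → ∃ λ i → f i ≡ x)

  Extremal : ℕ → Set
  Extremal n = HasLength n × HasExactly n JoinIrreducible × HasExactly n MeetIrreducible

  LeftModular : Elem → Set
  LeftModular x = ∀ y z → y ≤ z → (y ∨ x) ∧ z ≡ y ∨ (x ∧ z)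

  LeftModularChain : (n : ℕ) → (Fin (suc n) → Elem) → Set
  LeftModularChain n x = IsBottom (x zero) × IsTop (x (fromℕ n))
    × (∀ (i : Fin n) → x (inject₁ i) ⋖ x (suc i))
    × (∀ i → LeftModular (x i))

  -- left modular labelling, stated relationally:
  -- Label x y z i  means  γ(y ⋖ z) = toℕ i + 1  (label i+1 ∈ [n] is encoded by i : Fin n),
  -- i.e. i+1 is the least index j ∈ [n] with y ∨ (x_j ∧ z) = z.
  Label : {n : ℕ} → (Fin (suc n) → Elem) → Elem → Elem → Fin n → Set
  Label x y z i = (y ∨ (x (suc i) ∧ z) ≡ z) × (∀ j → j < i → y ∨ (x (suc j) ∧ z) ≢ z)

  Dγ : {n : ℕ} → (Fin (suc n) → Elem) → Elem → Fin n → Set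
  Dγ x y j = ∃ λ w → (w ⋖ y) × Label x w y j

  Uγ : {n : ℕ} → (Fin (suc n) → Elem) → Elem → Fin n → Set
  Uγ x y j = ∃ λ z → (y ⋖ z) × Label x y z j

_≐_ : {n : ℕ} → (Fin n → Set) → (Fin n → Set) → Set
P ≐ Q = ∀ j → P j ⇔ Q j

infix 4 _≐_

_⊆ₛ_ : {n : ℕ} → Subset n → (Fin n → Set) → Set
B ⊆ₛ P = ∀ j → j ∈ B → P j

_∈ₛ_ : {n : ℕ} → Fin n → Subset n → Set
j ∈ₛ B = j ∈ B

-- The chain x attaches to each join-irreducible j the unique index i with
-- j ≤ x (suc i) and j ≰ x (inject₁ i), and dually to each meet-irreducible;
-- as there are exactly n of each, every index i is carried by exactly one
-- join-irreducible J i and one meet-irreducible M i.  A cover y ⋖ z labelled i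
-- separates them (J i ≤ z, J i ≰ y, y ≤ M i, z ≰ M i), J i lies below every
-- other lower cover of z, and every other upper cover of y lies below M i.
-- Hence the labels of the lower covers of an element, like those of its upper
-- covers, form an independent set S: J i ≤ M k for distinct i, k ∈ S.  For
-- independent S the join of the J i (i ∈ S) has exactly S as its lower labels
-- and the meet of the M i (i ∈ S) has exactly S as its upper labels; subsets of
-- independent sets are independent, which gives all three claims.
module Submission where

open import Data.Empty using (⊥-elim)
open import Data.Fin using (Fin; zero; suc; inject₁; fromℕ; punchOut)
import Data.Fin as Fin
open import Data.Fin.Induction using (po-wellFounded)
open import Data.Fin.Properties
  using (_≟_; _<?_; any?; all?; <-cmp; ≤̄⇒inject₁<; toℕ-inject₁; punchOut-injective; <⇒notInjective)
import Data.Fin.Properties as Finₚ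
open import Data.Fin.Subset using (Subset; _∈_)
open import Data.Fin.Subset.Properties using (_∈?_)
open import Data.Nat using (ℕ; suc; zero; z≤n; s≤s) renaming (_≤_ to _≤ℕ_)
import Data.Nat.Properties as ℕₚ
open import Data.Product using (∃; _×_; Σ; _,_; proj₁; proj₂)
open import Data.Sum using (_⊎_; inj₁; inj₂)
open import Function using (flip; _∘_; case_of_)
open import Function.Bundles using (_⇔_; mk⇔; Equivalence)
open import Function.Definitions using (Injective)
open import Function.Properties.Equivalence using () renaming (sym to ⇔-sym)
open import Induction.WellFounded using (Acc; acc)
open import Relation.Binary.Definitions using (tri<; tri≈; tri>)
open import Relation.Binary.Lattice using (Lattice; IsLattice)
import Relation.Binary.Lattice.Properties.Lattice as LatticeProperties
import Relation.Binary.Lattice.Properties.JoinSemilattice as JoinSemilatticeProperties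
import Relation.Binary.Lattice.Properties.MeetSemilattice as MeetSemilatticeProperties
open import Relation.Binary.PropositionalEquality using (_≡_; _≢_; sym; trans; cong; subst)
import Relation.Binary.Reasoning.PartialOrder as PosetReasoning
open import Relation.Nullary using (¬_; Dec; yes; no; contradiction)
open import Relation.Nullary.Decidable using (_×-dec_; _→-dec_; ¬?; decidable-stable)
open import Relation.Unary using (Decidable)

open import Defs

<⇒suc≤inject₁ : ∀ {n} {i j : Fin n} → i Fin.< j → suc i Fin.≤ inject₁ j
<⇒suc≤inject₁ {j = j} i<j = subst (_≤ℕ_ _) (sym (toℕ-inject₁ j)) i<j

Threshold : ∀ {n} → (Fin (suc n) → Set) → Fin n → Set
Threshold P i = P (suc i) × ¬ P (inject₁ i)

threshold-exists : ∀ {n} {P : Fin (suc n) → Set} → Decidable P →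
                   ¬ P zero → P (fromℕ n) → ∃ (Threshold P)
threshold-exists {zero}  P? ¬P₀ Pₙ = contradiction Pₙ ¬P₀
threshold-exists {suc n} P? ¬P₀ Pₙ with P? (inject₁ (fromℕ n))
... | no ¬Pₙ₋₁ = fromℕ n , Pₙ , ¬Pₙ₋₁
... | yes Pₙ₋₁ with i , Pᵢ₊₁ , ¬Pᵢ ← threshold-exists (λ i → P? (inject₁ i)) ¬P₀ Pₙ₋₁
  = inject₁ i , Pᵢ₊₁ , ¬Pᵢ

threshold-unique : ∀ {n} {P : Fin (suc n) → Set} → (∀ {i j} → i Fin.≤ j → P i → P j) →
                   ∀ {i j} → Threshold P i → Threshold P j → i ≡ j
threshold-unique mono {i} {j} (Pᵢ₊₁ , ¬Pᵢ) (Pⱼ₊₁ , ¬Pⱼ) with <-cmp i j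
... | tri< i<j _ _ = contradiction (mono (<⇒suc≤inject₁ i<j) Pᵢ₊₁) ¬Pⱼ
... | tri≈ _ i≡j _ = i≡j
... | tri> _ _ j<i = contradiction (mono (<⇒suc≤inject₁ j<i) Pⱼ₊₁) ¬Pᵢ

injective⇒onto : ∀ {n} {h : Fin n → Fin n} → Injective _≡_ _≡_ h → ∀ c → ∃ λ i → h i ≡ c
injective⇒onto {zero} _ ()
injective⇒onto {suc n} {h} h-inj c with any? (λ i → h i ≟ c)
... | yes hit = hit
... | no miss = ⊥-elim (<⇒notInjective (ℕₚ.n<1+n n) squeeze)
  where
  avoids : ∀ i → c ≢ h i
  avoids i c≡hi = miss (i , sym c≡hi)
  squeeze : Injective _≡_ _≡_ (λ i → punchOut (avoids i))
  squeeze eq = h-inj (punchOut-injective (avoids _) (avoids _) eq)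

asLattice : FiniteLattice → Lattice _ _ _
asLattice L = record { isLattice = FiniteLattice.isLattice L }

dual : FiniteLattice → FiniteLattice
dual L = record
  { m = m ; _≤_ = flip _≤_ ; _∨_ = _∧_ ; _∧_ = _∨_
  ; isLattice = LatticeProperties.∧-∨-isLattice (asLattice L)
  }
  where open FiniteLattice L

-- Proved once here and transferred to the meet side through dual.
module JoinSideFacts (L : FiniteLattice) where
  open FiniteLattice L
  open IsLattice isLattice public
    using (x≤x∨y; y≤x∨y; ∨-least; x∧y≤x; x∧y≤y; ∧-greatest)
    renaming (refl to ≤-refl; trans to ≤-trans; antisym to ≤-antisym; reflexive to ≤-reflexive)

  infix 4 _≤?_
  _≤?_ : ∀ a b → Dec (a ≤ b)
  a ≤? b with a ∨ b ≟ b
  ... | yes a∨b≡b = yes (subst (a ≤_) a∨b≡b (x≤x∨y a b))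
  ... | no  a∨b≢b = no λ a≤b → a∨b≢b (≤-antisym (∨-least a≤b ≤-refl) (y≤x∨y a b))

  minimal : {P : Elem → Set} → Decidable P → ∀ {w₀} → P w₀ →
            Σ Elem λ w → P w × (∀ {w′} → P w′ → w′ ≤ w → w′ ≡ w)
  minimal {P} P? {w₀} Pw₀ = descend w₀ Pw₀ (po-wellFounded (IsLattice.isPartialOrder isLattice) w₀)
    where
    descend : ∀ w → P w → Acc _<ₗ_ w → Σ Elem λ w → P w × (∀ {w′} → P w′ → w′ ≤ w → w′ ≡ w)
    descend w Pw (acc rec) with any? (λ w′ → P? w′ ×-dec ((w′ ≤? w) ×-dec ¬? (w′ ≟ w)))
    ... | yes (w′ , Pw′ , w′<w) = descend w′ Pw′ (rec w′<w)
    ... | no  nothing-below = w , Pw , λ {w′} Pw′ w′≤w → case w′ ≟ w of λ where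
      (yes w′≡w) → w′≡w
      (no  w′≢w) → contradiction (w′ , Pw′ , w′≤w , w′≢w) nothing-below

  joinIrreducible-below : ∀ {a b} → ¬ (a ≤ b) → Σ Elem λ j → JoinIrreducible j × j ≤ a × ¬ (j ≤ b)
  joinIrreducible-below {a} {b} a≰b
    with j , (j≤a , j≰b) , least ← minimal (λ w → (w ≤? a) ×-dec ¬? (w ≤? b)) (≤-refl , a≰b)
    = j , ((λ j-bottom → j≰b (j-bottom b)) , irreducible) , j≤a , j≰b
    where
    strictly-below⇒≤b : ∀ {y} → y ≤ j → y ≢ j → y ≤ b
    strictly-below⇒≤b {y} y≤j y≢j with y ≤? b
    ... | yes y≤b = y≤b
    ... | no  y≰b = contradiction (least (≤-trans y≤j j≤a , y≰b) y≤j) y≢j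
    irreducible : ∀ y z → j ≡ y ∨ z → j ≡ y ⊎ j ≡ z
    irreducible y z j≡y∨z with j ≟ y | j ≟ z
    ... | yes j≡y | _       = inj₁ j≡y
    ... | no _    | yes j≡z = inj₂ j≡z
    ... | no j≢y  | no j≢z  = contradiction (subst (_≤ b) (sym j≡y∨z) (∨-least y≤b z≤b)) j≰b
      where
      y≤b = strictly-below⇒≤b (subst (y ≤_) (sym j≡y∨z) (x≤x∨y y z)) (j≢y ∘ sym)
      z≤b = strictly-below⇒≤b (subst (z ≤_) (sym j≡y∨z) (y≤x∨y y z)) (j≢z ∘ sym)

  IsJoinOf : ∀ {k} → (Fin k → Set) → (Fin k → Elem) → Elem → Set
  IsJoinOf S f s = (∀ i → S i → f i ≤ s) × (∀ {u} → (∀ i → S i → f i ≤ u) → s ≤ u)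

  join-exists : ∀ {bot} → IsBottom bot → ∀ {k} {S : Fin k → Set} → Decidable S →
                (f : Fin k → Elem) → ∃ (IsJoinOf S f)
  join-exists bot-least {zero} S? f = _ , (λ ()) , λ _ → bot-least _
  join-exists bot-least {suc k} {S} S? f
    with s , upper , least ← join-exists bot-least (S? ∘ suc) (f ∘ suc) | S? zero
  ... | yes S₀ = f zero ∨ s , upper′ , λ bound → ∨-least (bound zero S₀) (least (bound ∘ suc))
    where
    upper′ : ∀ i → S i → f i ≤ f zero ∨ s
    upper′ zero    _  = x≤x∨y _ _
    upper′ (suc i) Sᵢ = ≤-trans (upper i Sᵢ) (y≤x∨y _ _)
  ... | no ¬S₀ = s , upper′ , λ bound → least (bound ∘ suc)
    where
    upper′ : ∀ i → S i → f i ≤ s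
    upper′ zero    S₀ = contradiction S₀ ¬S₀
    upper′ (suc i) Sᵢ = upper i Sᵢ

module LatticeFacts (L : FiniteLattice) where
  open FiniteLattice L
  open JoinSideFacts L public
  private module Op = JoinSideFacts (dual L)
  open JoinSemilatticeProperties (Lattice.joinSemilattice (asLattice L)) public using (∨-monotonic)
  open MeetSemilatticeProperties (Lattice.meetSemilattice (asLattice L)) public using (∧-monotonic)

  maximal : {P : Elem → Set} → Decidable P → ∀ {w₀} → P w₀ →
            Σ Elem λ w → P w × (∀ {w′} → P w′ → w ≤ w′ → w′ ≡ w)
  maximal = Op.minimal

  meetIrreducible-above : ∀ {a b} → ¬ (a ≤ b) → Σ Elem λ m → MeetIrreducible m × b ≤ m × ¬ (a ≤ m)
  meetIrreducible-above = Op.joinIrreducible-below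

  IsMeetOf : ∀ {k} → (Fin k → Set) → (Fin k → Elem) → Elem → Set
  IsMeetOf S f s = (∀ i → S i → s ≤ f i) × (∀ {u} → (∀ i → S i → u ≤ f i) → u ≤ s)

  meet-exists : ∀ {top} → IsTop top → ∀ {k} {S : Fin k → Set} → Decidable S →
                (f : Fin k → Elem) → ∃ (IsMeetOf S f)
  meet-exists = Op.join-exists

  ⋖⇒≤ : ∀ {y z} → y ⋖ z → y ≤ z
  ⋖⇒≤ ((y≤z , _) , _) = y≤z

  ⋖⇒≱ : ∀ {y z} → y ⋖ z → ¬ (z ≤ y)
  ⋖⇒≱ ((y≤z , y≢z) , _) z≤y = y≢z (≤-antisym y≤z z≤y)

  ⋖-above : ∀ {y z w} → y ⋖ z → y ≤ w → w ≤ z → ¬ (w ≤ y) → z ≤ w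
  ⋖-above {w = w} (_ , nothing-between) y≤w w≤z w≰y with w ≟ _
  ... | yes w≡z = ≤-reflexive (sym w≡z)
  ... | no  w≢z = contradiction ((y≤w , w≰y ∘ ≤-reflexive ∘ sym) , w≤z , w≢z) (nothing-between w)

  ⋖-below : ∀ {y z w} → y ⋖ z → y ≤ w → w ≤ z → ¬ (z ≤ w) → w ≤ y
  ⋖-below {y} {w = w} (_ , nothing-between) y≤w w≤z z≰w with w ≟ y
  ... | yes w≡y = ≤-reflexive w≡y
  ... | no  w≢y = contradiction ((y≤w , w≢y ∘ sym) , w≤z , z≰w ∘ ≤-reflexive ∘ sym) (nothing-between w)

  ⋖-join : ∀ {y z w} → y ⋖ z → w ≤ z → ¬ (w ≤ y) → z ≤ y ∨ w
  ⋖-join y⋖z w≤z w≰y =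
    ⋖-above y⋖z (x≤x∨y _ _) (∨-least (⋖⇒≤ y⋖z) w≤z) (w≰y ∘ ≤-trans (y≤x∨y _ _))

  ⋖-lower-unique : ∀ {y y′ z} → y ⋖ z → y′ ⋖ z → y′ ≤ y → y′ ≡ y
  ⋖-lower-unique y⋖z y′⋖z y′≤y = ≤-antisym y′≤y (⋖-below y′⋖z y′≤y (⋖⇒≤ y⋖z) (⋖⇒≱ y⋖z))

  ⋖-upper-unique : ∀ {y z z′} → y ⋖ z → y ⋖ z′ → z ≤ z′ → z ≡ z′
  ⋖-upper-unique y⋖z y⋖z′ z≤z′ = ≤-antisym z≤z′ (⋖-above y⋖z′ (⋖⇒≤ y⋖z) z≤z′ (⋖⇒≱ y⋖z))

  lowerCover-above : ∀ {t c} → t ≤ c → ¬ (c ≤ t) → Σ Elem λ u → t ≤ u × u ⋖ c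
  lowerCover-above {t} {c} t≤c c≰t
    with u , (t≤u , u≤c , c≰u) , greatest ←
           maximal (λ u → (t ≤? u) ×-dec (u ≤? c) ×-dec ¬? (c ≤? u)) (≤-refl , t≤c , c≰t)
    = u , t≤u , (u≤c , c≰u ∘ ≤-reflexive ∘ sym) , λ w ((u≤w , u≢w) , w≤c , w≢c) →
        u≢w (sym (greatest (≤-trans t≤u u≤w , w≤c , w≢c ∘ ≤-antisym w≤c) u≤w))

  upperCover-below : ∀ {b t} → b ≤ t → ¬ (t ≤ b) → Σ Elem λ z → b ⋖ z × z ≤ t
  upperCover-below {b} {t} b≤t t≰b
    with z , (b≤z , z≰b , z≤t) , least ←
           minimal (λ z → (b ≤? z) ×-dec ¬? (z ≤? b) ×-dec (z ≤? t)) (b≤t , t≰b , ≤-refl)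
    = z , ((b≤z , z≰b ∘ ≤-reflexive ∘ sym) , λ w ((b≤w , b≢w) , w≤z , w≢z) →
        w≢z (least (b≤w , b≢w ∘ ≤-antisym b≤w , ≤-trans w≤z z≤t) w≤z)) , z≤t

  stepwise-monotone : ∀ {k} (c : Fin (suc k) → Elem) → (∀ i → c (inject₁ i) ≤ c (suc i)) →
                      ∀ {i j} → i Fin.≤ j → c i ≤ c j
  stepwise-monotone c step {zero} {zero} _ = ≤-refl
  stepwise-monotone {suc k} c step {zero} {suc j} _ =
    ≤-trans (step zero) (stepwise-monotone (c ∘ suc) (step ∘ suc) {zero} {j} z≤n)
  stepwise-monotone {suc k} c step {suc i} {suc j} (s≤s i≤j) =
    stepwise-monotone (c ∘ suc) (step ∘ suc) i≤j

  -- The carriers have pairwise distinct labels, so their indices form an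
  -- injective, hence onto, self-map of Fin n: every irreducible is a carrier.
  label-determines-element :
    ∀ {n} {Irr : Elem → Set} {Label : Elem → Fin n → Set} → HasExactly n Irr →
    (∀ {e i j} → Label e i → Label e j → i ≡ j) →
    (carrier : ∀ i → Σ Elem λ e → Irr e × Label e i) →
    ∀ {e i} → Irr e → Label e i → e ≡ proj₁ (carrier i)
  label-determines-element {Irr = Irr} {Label} (f , _ , _ , enumerates) label-unique carrier
                           {e} {i} Irr-e eᵢ = sym (subst (λ j → c j ≡ e) q≡i cq≡e)
    where
    c : Fin _ → Elem
    c = proj₁ ∘ carrier
    carries : ∀ q → Label (c q) q
    carries q = proj₂ (proj₂ (carrier q))
    index : ∀ {a} → Irr a → Fin _
    index {a} Irr-a = proj₁ (enumerates a Irr-a)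
    index∘carrier : Fin _ → Fin _
    index∘carrier q = index (proj₁ (proj₂ (carrier q)))
    c≡f∘index∘carrier : ∀ q → c q ≡ f (index∘carrier q)
    c≡f∘index∘carrier q = sym (proj₂ (enumerates (c q) (proj₁ (proj₂ (carrier q)))))
    index∘carrier-injective : Injective _≡_ _≡_ index∘carrier
    index∘carrier-injective {p} {q} same-index =
      label-unique (carries p) (subst (λ a → Label a q) (sym cp≡cq) (carries q))
      where cp≡cq = trans (c≡f∘index∘carrier p) (trans (cong f same-index) (sym (c≡f∘index∘carrier q)))
    hit : ∃ λ q → index∘carrier q ≡ index Irr-e
    hit = injective⇒onto index∘carrier-injective (index Irr-e)
    q = proj₁ hit
    cq≡e : c q ≡ e
    cq≡e = trans (c≡f∘index∘carrier q) (trans (cong f (proj₂ hit)) (proj₂ (enumerates e Irr-e)))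
    q≡i : q ≡ i
    q≡i = label-unique (subst (λ a → Label a q) cq≡e (carries q)) eᵢ

  _⋖?_ : ∀ y z → Dec (y ⋖ z)
  y ⋖? z = ((y ≤? z) ×-dec ¬? (y ≟ z)) ×-dec
           all? (λ w → ¬? (((y ≤? w) ×-dec ¬? (y ≟ w)) ×-dec ((w ≤? z) ×-dec ¬? (w ≟ z))))

  module ≤-Reasoning = PosetReasoning (Lattice.poset (asLattice L))

module LeftModularLabelling
  (L : FiniteLattice) {n : ℕ} (x : Fin (suc n) → FiniteLattice.Elem L)
  (joins : FiniteLattice.HasExactly L n (FiniteLattice.JoinIrreducible L))
  (meets : FiniteLattice.HasExactly L n (FiniteLattice.MeetIrreducible L))
  (chain : FiniteLattice.LeftModularChain L n x)
  where
  open FiniteLattice L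
  open LatticeFacts L

  x₀-least : IsBottom (x zero)
  x₀-least = proj₁ chain

  xₙ-greatest : IsTop (x (fromℕ n))
  xₙ-greatest = proj₁ (proj₂ chain)

  x-covers : ∀ i → x (inject₁ i) ⋖ x (suc i)
  x-covers = proj₁ (proj₂ (proj₂ chain))

  x-leftModular : ∀ q → LeftModular (x q)
  x-leftModular = proj₂ (proj₂ (proj₂ chain))

  x-mono : ∀ {p q} → p Fin.≤ q → x p ≤ x q
  x-mono = stepwise-monotone x (⋖⇒≤ ∘ x-covers)

  x-suc≤x-inject₁ : ∀ {i k} → i Fin.< k → x (suc i) ≤ x (inject₁ k)
  x-suc≤x-inject₁ = x-mono ∘ <⇒suc≤inject₁

  z≤y∨x⇒z≤y∨[x∧z] : ∀ {y z} q → y ≤ z → z ≤ y ∨ x q → z ≤ y ∨ (x q ∧ z)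
  z≤y∨x⇒z≤y∨[x∧z] q y≤z z≤y∨x = subst (_ ≤_) (x-leftModular q _ _ y≤z) (∧-greatest z≤y∨x ≤-refl)

  y∨[x∧z]≡z⇔z≤y∨x : ∀ {y z} q → y ≤ z → (y ∨ (x q ∧ z) ≡ z) ⇔ (z ≤ y ∨ x q)
  y∨[x∧z]≡z⇔z≤y∨x q y≤z = mk⇔
    (λ eq → subst (_≤ _) eq (∨-monotonic ≤-refl (x∧y≤x _ _)))
    (λ z≤y∨x → ≤-antisym (∨-least y≤z (x∧y≤y _ _)) (z≤y∨x⇒z≤y∨[x∧z] q y≤z z≤y∨x))

  JLabel : Elem → Fin n → Set
  JLabel e = Threshold (λ q → e ≤ x q)

  MLabel : Elem → Fin n → Set
  MLabel e i = x (inject₁ i) ≤ e × ¬ (x (suc i) ≤ e)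

  jLabel-unique : ∀ {e i j} → JLabel e i → JLabel e j → i ≡ j
  jLabel-unique = threshold-unique λ p≤q e≤xp → ≤-trans e≤xp (x-mono p≤q)

  mLabel-unique : ∀ {e i j} → MLabel e i → MLabel e j → i ≡ j
  mLabel-unique (lo , hi) (lo′ , hi′) =
    threshold-unique (λ p≤q xp≰e xq≤e → xp≰e (≤-trans (x-mono p≤q) xq≤e))
                     (hi , λ ¬lo → ¬lo lo) (hi′ , λ ¬lo′ → ¬lo′ lo′)

  J-carrier : ∀ i → Σ Elem λ e → JoinIrreducible e × JLabel e i
  J-carrier i = joinIrreducible-below (⋖⇒≱ (x-covers i))

  M-carrier : ∀ i → Σ Elem λ e → MeetIrreducible e × MLabel e i
  M-carrier i = meetIrreducible-above (⋖⇒≱ (x-covers i))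

  J M : Fin n → Elem
  J i = proj₁ (J-carrier i)
  M i = proj₁ (M-carrier i)

  J-unique : ∀ {e i} → JoinIrreducible e → JLabel e i → e ≡ J i
  J-unique = label-determines-element joins jLabel-unique J-carrier

  M-unique : ∀ {e i} → MeetIrreducible e → MLabel e i → e ≡ M i
  M-unique = label-determines-element meets mLabel-unique M-carrier

  J≤x : ∀ i → J i ≤ x (suc i)
  J≤x i = proj₁ (proj₂ (proj₂ (J-carrier i)))

  J≰x : ∀ i → ¬ (J i ≤ x (inject₁ i))
  J≰x i = proj₂ (proj₂ (proj₂ (J-carrier i)))

  x≤M : ∀ i → x (inject₁ i) ≤ M i
  x≤M i = proj₁ (proj₂ (proj₂ (M-carrier i)))

  x≰M : ∀ i → ¬ (x (suc i) ≤ M i)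
  x≰M i = proj₂ (proj₂ (proj₂ (M-carrier i)))

  J≰M : ∀ i → ¬ (J i ≤ M i)
  J≰M i Jᵢ≤Mᵢ = x≰M i (≤-trans (⋖-join (x-covers i) (J≤x i) (J≰x i)) (∨-least (x≤M i) Jᵢ≤Mᵢ))

  J≤M : ∀ {i k} → i Fin.< k → J i ≤ M k
  J≤M {i} {k} i<k = ≤-trans (J≤x i) (≤-trans (x-suc≤x-inject₁ i<k) (x≤M k))

  M∧x≤x : ∀ i → M i ∧ x (suc i) ≤ x (inject₁ i)
  M∧x≤x i = ⋖-below (x-covers i) (∧-greatest (x≤M i) (⋖⇒≤ (x-covers i))) (x∧y≤y _ _)
                    (λ x≤M∧x → x≰M i (≤-trans x≤M∧x (x∧y≤x _ _)))

  y∨x₀≤y : ∀ y → y ∨ x zero ≤ y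
  y∨x₀≤y y = ∨-least ≤-refl (x₀-least y)

  z≤y∨xₙ : ∀ y z → z ≤ y ∨ x (fromℕ n)
  z≤y∨xₙ y z = ≤-trans (xₙ-greatest z) (y≤x∨y y _)

  -- In local names, x⁻ and x⁺ stand for x (inject₁ p) and x (suc p).
  threshold⇒J : ∀ {u v p} → u ≤ v → Threshold (λ q → v ≤ u ∨ x q) p →
                J p ≤ v × ¬ (J p ≤ u ∨ x (inject₁ p))
  threshold⇒J {u} {v} {p} u≤v (v≤u∨x⁺ , v≰u∨x⁻) = conclude (joinIrreducible-below x⁺∧v≰u∨x⁻)
    where
    x⁺∧v≰u∨x⁻ : ¬ (x (suc p) ∧ v ≤ u ∨ x (inject₁ p))
    x⁺∧v≰u∨x⁻ x⁺∧v≤u∨x⁻ =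
      v≰u∨x⁻ (≤-trans (z≤y∨x⇒z≤y∨[x∧z] (suc p) u≤v v≤u∨x⁺) (∨-least (x≤x∨y _ _) x⁺∧v≤u∨x⁻))
    conclude : (Σ Elem λ j → JoinIrreducible j × j ≤ x (suc p) ∧ v × ¬ (j ≤ u ∨ x (inject₁ p))) →
               J p ≤ v × ¬ (J p ≤ u ∨ x (inject₁ p))
    conclude (j , irr , j≤x⁺∧v , j≰u∨x⁻) =
      subst (_≤ v) j≡Jp (≤-trans j≤x⁺∧v (x∧y≤y _ _)) , subst (λ e → ¬ (e ≤ u ∨ _)) j≡Jp j≰u∨x⁻
      where
      j≡Jp : j ≡ J p
      j≡Jp = J-unique irr (≤-trans j≤x⁺∧v (x∧y≤x _ _) , λ j≤x⁻ → j≰u∨x⁻ (≤-trans j≤x⁻ (y≤x∨y _ _)))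

  threshold⇒M : ∀ {u v p} → u ≤ v → x (inject₁ p) ∧ v ≤ u → ¬ (x (suc p) ∧ v ≤ u) →
                u ∨ x (inject₁ p) ≤ M p × ¬ (v ≤ M p)
  threshold⇒M {u} {v} {p} u≤v x⁻∧v≤u x⁺∧v≰u = conclude (meetIrreducible-above x⁺≰u∨x⁻)
    where
    x⁺≰u∨x⁻ : ¬ (x (suc p) ≤ u ∨ x (inject₁ p))
    x⁺≰u∨x⁻ x⁺≤u∨x⁻ = x⁺∧v≰u (begin
      x (suc p) ∧ v               ≤⟨ ∧-monotonic x⁺≤u∨x⁻ ≤-refl ⟩
      (u ∨ x (inject₁ p)) ∧ v     ≡⟨ x-leftModular (inject₁ p) u v u≤v ⟩
      u ∨ (x (inject₁ p) ∧ v)     ≤⟨ ∨-least ≤-refl x⁻∧v≤u ⟩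
      u                           ∎)
      where open ≤-Reasoning
    v≰Mp : ¬ (v ≤ M p)
    v≰Mp v≤Mp = x⁺∧v≰u (begin
      x (suc p) ∧ v                 ≤⟨ ∧-greatest (∧-greatest (≤-trans (x∧y≤y _ _) v≤Mp) (x∧y≤x _ _)) (x∧y≤y _ _) ⟩
      (M p ∧ x (suc p)) ∧ v         ≤⟨ ∧-monotonic (M∧x≤x p) ≤-refl ⟩
      x (inject₁ p) ∧ v             ≤⟨ x⁻∧v≤u ⟩
      u                             ∎)
      where open ≤-Reasoning
    conclude : (Σ Elem λ m → MeetIrreducible m × u ∨ x (inject₁ p) ≤ m × ¬ (x (suc p) ≤ m)) →
               u ∨ x (inject₁ p) ≤ M p × ¬ (v ≤ M p)
    conclude (m , irr , u∨x⁻≤m , x⁺≰m) =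
      subst (_ ≤_) (M-unique irr (≤-trans (y≤x∨y _ _) u∨x⁻≤m , x⁺≰m)) u∨x⁻≤m , v≰Mp

  CoverLabel : Elem → Elem → Fin n → Set
  CoverLabel y z = Threshold (λ q → z ≤ y ∨ x q)

  coverLabel-exists : ∀ {y z} → y ⋖ z → ∃ (CoverLabel y z)
  coverLabel-exists {y} {z} y⋖z = threshold-exists (λ q → z ≤? y ∨ x q)
    (λ z≤y∨x₀ → ⋖⇒≱ y⋖z (≤-trans z≤y∨x₀ (y∨x₀≤y y))) (z≤y∨xₙ y z)

  coverLabel-unique : ∀ {y z i k} → CoverLabel y z i → CoverLabel y z k → i ≡ k
  coverLabel-unique = threshold-unique λ p≤q z≤y∨xp → ≤-trans z≤y∨xp (∨-monotonic ≤-refl (x-mono p≤q))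

  Label⇒CoverLabel : ∀ {y z i} → y ⋖ z → Label x y z i → CoverLabel y z i
  Label⇒CoverLabel {y} {z} {i} y⋖z (reaches , earlier-fail) = reaches′ , fails-below i earlier-fail
    where
    reaches′ = Equivalence.to (y∨[x∧z]≡z⇔z≤y∨x (suc i) (⋖⇒≤ y⋖z)) reaches
    fails-below : ∀ i → (∀ j → j Fin.< i → y ∨ (x (suc j) ∧ z) ≢ z) → ¬ (z ≤ y ∨ x (inject₁ i))
    fails-below zero    _  z≤y∨x₀ = ⋖⇒≱ y⋖z (≤-trans z≤y∨x₀ (y∨x₀≤y y))
    fails-below (suc j) earlier z≤y∨x = earlier (inject₁ j) (≤̄⇒inject₁< ℕₚ.≤-refl)
      (Equivalence.from (y∨[x∧z]≡z⇔z≤y∨x (suc (inject₁ j)) (⋖⇒≤ y⋖z)) z≤y∨x)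

  CoverLabel⇒Label : ∀ {y z i} → y ⋖ z → CoverLabel y z i → Label x y z i
  CoverLabel⇒Label {y} {z} {i} y⋖z (z≤y∨x⁺ , z≰y∨x⁻) =
    Equivalence.from (y∨[x∧z]≡z⇔z≤y∨x (suc i) (⋖⇒≤ y⋖z)) z≤y∨x⁺ ,
    λ j j<i reaches → z≰y∨x⁻ (≤-trans (Equivalence.to (y∨[x∧z]≡z⇔z≤y∨x (suc j) (⋖⇒≤ y⋖z)) reaches)
                                      (∨-monotonic ≤-refl (x-suc≤x-inject₁ j<i)))

  coverLabel-low : ∀ {y z i} → y ⋖ z → CoverLabel y z i → x (inject₁ i) ∧ z ≤ y
  coverLabel-low y⋖z (_ , z≰y∨x⁻) =
    ≤-trans (y≤x∨y _ _) (⋖-below y⋖z (x≤x∨y _ _) (∨-least (⋖⇒≤ y⋖z) (x∧y≤y _ _))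
                                 (λ z≤y∨[x⁻∧z] → z≰y∨x⁻ (≤-trans z≤y∨[x⁻∧z] (∨-monotonic ≤-refl (x∧y≤x _ _)))))

  coverLabel-high : ∀ {y z i} → y ⋖ z → CoverLabel y z i → ¬ (x (suc i) ∧ z ≤ y)
  coverLabel-high {i = i} y⋖z (z≤y∨x⁺ , _) x⁺∧z≤y =
    ⋖⇒≱ y⋖z (≤-trans (z≤y∨x⇒z≤y∨[x∧z] (suc i) (⋖⇒≤ y⋖z) z≤y∨x⁺) (∨-least ≤-refl x⁺∧z≤y))

  coverLabel-J : ∀ {y z i} → y ⋖ z → CoverLabel y z i → J i ≤ z × ¬ (J i ≤ y)
  coverLabel-J {y} {z} {i} y⋖z ℓ =
    proj₁ Ji-threshold , λ Ji≤y → proj₂ Ji-threshold (≤-trans Ji≤y (x≤x∨y _ _))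
    where
    Ji-threshold : J i ≤ z × ¬ (J i ≤ y ∨ x (inject₁ i))
    Ji-threshold = threshold⇒J (⋖⇒≤ y⋖z) ℓ

  coverLabel-M : ∀ {y z i} → y ⋖ z → CoverLabel y z i → y ≤ M i × ¬ (z ≤ M i)
  coverLabel-M {y} {z} {i} y⋖z ℓ = ≤-trans (x≤x∨y _ _) (proj₁ Mi-threshold) , proj₂ Mi-threshold
    where
    Mi-threshold : y ∨ x (inject₁ i) ≤ M i × ¬ (z ≤ M i)
    Mi-threshold = threshold⇒M (⋖⇒≤ y⋖z) (coverLabel-low y⋖z ℓ) (coverLabel-high y⋖z ℓ)

  coverLabel≤ : ∀ {y z p q} → y ⋖ z → CoverLabel y z p → J q ≤ z → ¬ (J q ≤ y) → p Fin.≤ q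
  coverLabel≤ {y} {z} {p} {q} y⋖z (_ , z≰y∨x⁻) Jq≤z Jq≰y with q <? p
  ... | no  q≮p = ℕₚ.≮⇒≥ q≮p
  ... | yes q<p = contradiction (≤-trans (⋖-join y⋖z Jq≤z Jq≰y)
                                   (∨-monotonic ≤-refl (≤-trans (J≤x q) (x-suc≤x-inject₁ q<p)))) z≰y∨x⁻

  ≤coverLabel : ∀ {y z p q} → y ⋖ z → CoverLabel y z p → y ≤ M q → ¬ (z ≤ M q) → q Fin.≤ p
  ≤coverLabel {y} {z} {p} {q} y⋖z ℓ y≤Mq z≰Mq with p <? q
  ... | no  p≮q = ℕₚ.≮⇒≥ p≮q
  ... | yes p<q = contradiction (≤-trans (⋖-join y⋖z Jp≤z Jp≰y) (∨-least y≤Mq (J≤M p<q))) z≰Mq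
    where
    Jp≤z = proj₁ (coverLabel-J y⋖z ℓ)
    Jp≰y = proj₂ (coverLabel-J y⋖z ℓ)

  -- The index p at which y′ enters (y ∧ y′) ∨ x p can be neither below i
  -- (then y′ ≤ y) nor above it (then J p ≤ y ∧ y′), so J i = J p ≤ y′.
  J-below-lower-cover-with-smaller-label : ∀ {y y′ z i k} → y ⋖ z → y′ ⋖ z →
    CoverLabel y z i → CoverLabel y′ z k → k Fin.< i → J i ≤ y′
  J-below-lower-cover-with-smaller-label {y} {y′} {z} {i} {k} y⋖z y′⋖z ℓ ℓ′ k<i =
    via-meet (threshold-exists (λ q → y′ ≤? c₀ ∨ x q) y′≰c₀∨x₀ (z≤y∨xₙ c₀ y′))
    where
    c₀ = y ∧ y′
    y′≰y : ¬ (y′ ≤ y)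
    y′≰y y′≤y = Finₚ.<-irrefl
      (sym (coverLabel-unique ℓ (subst (λ w → CoverLabel w z k) (⋖-lower-unique y⋖z y′⋖z y′≤y) ℓ′))) k<i
    y′≰c₀∨x₀ : ¬ (y′ ≤ c₀ ∨ x zero)
    y′≰c₀∨x₀ y′≤c₀∨x₀ = y′≰y (≤-trans y′≤c₀∨x₀ (≤-trans (y∨x₀≤y c₀) (x∧y≤x y y′)))
    via-meet : ∃ (Threshold (λ q → y′ ≤ c₀ ∨ x q)) → J i ≤ y′
    via-meet (p , th@(y′≤c₀∨x⁺ , y′≰c₀∨x⁻)) with <-cmp p i
    ... | tri≈ _ p≡i _ = subst (λ q → J q ≤ y′) p≡i (proj₁ (threshold⇒J (x∧y≤y y y′) th))
    ... | tri< p<i _ _ = contradiction y′≤y y′≰y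
      where
      open ≤-Reasoning
      y′≤y : y′ ≤ y
      y′≤y = begin
        y′                          ≤⟨ ∧-greatest y′≤c₀∨x⁺ (⋖⇒≤ y′⋖z) ⟩
        (c₀ ∨ x (suc p)) ∧ z        ≤⟨ ∧-monotonic (∨-monotonic ≤-refl (x-suc≤x-inject₁ p<i)) ≤-refl ⟩
        (c₀ ∨ x (inject₁ i)) ∧ z    ≡⟨ x-leftModular (inject₁ i) c₀ z (≤-trans (x∧y≤x y y′) (⋖⇒≤ y⋖z)) ⟩
        c₀ ∨ (x (inject₁ i) ∧ z)    ≤⟨ ∨-least (x∧y≤x y y′) (coverLabel-low y⋖z ℓ) ⟩
        y                           ∎
    ... | tri> _ _ i<p = contradiction (≤-trans (∧-greatest Jp≤y Jp≤y′) (x≤x∨y _ _)) Jp≰c₀∨x⁻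
      where
      Jp≤y′ = proj₁ (threshold⇒J (x∧y≤y y y′) th)
      Jp≰c₀∨x⁻ = proj₂ (threshold⇒J (x∧y≤y y y′) th)
      y≤c₀∨x⁺ : y ≤ c₀ ∨ x (suc p)
      y≤c₀∨x⁺ = ≤-trans (⋖⇒≤ y⋖z) (≤-trans (proj₁ ℓ′)
        (∨-least y′≤c₀∨x⁺ (≤-trans (x-mono (s≤s (ℕₚ.<⇒≤ (ℕₚ.<-trans k<i i<p)))) (y≤x∨y _ _))))
      y≰c₀∨x⁻ : ¬ (y ≤ c₀ ∨ x (inject₁ p))
      y≰c₀∨x⁻ y≤c₀∨x⁻ = y′≰c₀∨x⁻ (≤-trans (⋖⇒≤ y′⋖z) (≤-trans (proj₁ ℓ)
        (∨-least y≤c₀∨x⁻ (≤-trans (x-suc≤x-inject₁ i<p) (y≤x∨y _ _)))))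
      Jp≤y = proj₁ (threshold⇒J (x∧y≤x y y′) (y≤c₀∨x⁺ , y≰c₀∨x⁻))

  J-below-other-lower-cover : ∀ {y y′ z i k} → y ⋖ z → y′ ⋖ z →
                              CoverLabel y z i → CoverLabel y′ z k → i ≢ k → J i ≤ y′
  J-below-other-lower-cover {i = i} y⋖z y′⋖z ℓ ℓ′ i≢k with <-cmp i _
  ... | tri< i<k _ _ = ≤-trans (∧-greatest (≤-trans (J≤x i) (x-suc≤x-inject₁ i<k)) (proj₁ (coverLabel-J y⋖z ℓ)))
                               (coverLabel-low y′⋖z ℓ′)
  ... | tri≈ _ i≡k _ = contradiction i≡k i≢k
  ... | tri> _ _ k<i = J-below-lower-cover-with-smaller-label y⋖z y′⋖z ℓ ℓ′ k<i

  -- The index p at which x p ∧ (z ∨ z′) leaves z′ can be neither above i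
  -- (then z ≤ z′) nor below it (then z ∨ z′ ≤ M p), so z′ ≤ M p = M i.
  upper-cover-with-larger-label-below-M : ∀ {b z z′ i k} → b ⋖ z → b ⋖ z′ →
    CoverLabel b z i → CoverLabel b z′ k → i Fin.< k → z′ ≤ M i
  upper-cover-with-larger-label-below-M {b} {z} {z′} {i} {k} b⋖z b⋖z′ ℓ ℓ′ i<k =
    via-join (threshold-exists (λ q → ¬? (x q ∧ d ≤? z′)) ¬x₀∧d≰z′ xₙ∧d≰z′)
    where
    d = z ∨ z′
    z≰z′ : ¬ (z ≤ z′)
    z≰z′ z≤z′ = Finₚ.<-irrefl
      (coverLabel-unique ℓ (subst (λ w → CoverLabel b w k) (sym (⋖-upper-unique b⋖z b⋖z′ z≤z′)) ℓ′)) i<k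
    ¬x₀∧d≰z′ : ¬ ¬ (x zero ∧ d ≤ z′)
    ¬x₀∧d≰z′ x₀∧d≰z′ = x₀∧d≰z′ (≤-trans (x∧y≤x _ _) (x₀-least z′))
    xₙ∧d≰z′ : ¬ (x (fromℕ n) ∧ d ≤ z′)
    xₙ∧d≰z′ xₙ∧d≤z′ = z≰z′ (≤-trans (x≤x∨y z z′) (≤-trans (∧-greatest (xₙ-greatest d) ≤-refl) xₙ∧d≤z′))
    via-join : ∃ (Threshold (λ q → ¬ (x q ∧ d ≤ z′))) → z′ ≤ M i
    via-join (p , x⁺∧d≰z′ , ¬x⁻∧d≰z′) with <-cmp p i | decidable-stable (_ ≤? z′) ¬x⁻∧d≰z′
    ... | tri≈ _ p≡i _ | x⁻∧d≤z′ = ≤-trans (x≤x∨y z′ _)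
      (subst (λ q → z′ ∨ x (inject₁ q) ≤ M q) p≡i (proj₁ (threshold⇒M (y≤x∨y z z′) x⁻∧d≤z′ x⁺∧d≰z′)))
    ... | tri> _ _ i<p | x⁻∧d≤z′ = contradiction z≤z′ z≰z′
      where
      open ≤-Reasoning
      z≤z′ : z ≤ z′
      z≤z′ = begin
        z                           ≤⟨ ∧-greatest (proj₁ ℓ) (x≤x∨y z z′) ⟩
        (b ∨ x (suc i)) ∧ d         ≡⟨ x-leftModular (suc i) b d (≤-trans (⋖⇒≤ b⋖z) (x≤x∨y z z′)) ⟩
        b ∨ (x (suc i) ∧ d)         ≤⟨ ∨-least (⋖⇒≤ b⋖z′) (≤-trans (∧-monotonic (x-suc≤x-inject₁ i<p) ≤-refl) x⁻∧d≤z′) ⟩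
        z′                          ∎
    ... | tri< p<i _ _ | x⁻∧d≤z′ = contradiction d≤Mp (proj₂ A)
      where
      open ≤-Reasoning
      A : z′ ∨ x (inject₁ p) ≤ M p × ¬ (d ≤ M p)
      A = threshold⇒M (y≤x∨y z z′) x⁻∧d≤z′ x⁺∧d≰z′
      x⁻∧d≤z : x (inject₁ p) ∧ d ≤ z
      x⁻∧d≤z = begin
        x (inject₁ p) ∧ d           ≤⟨ ∧-greatest (≤-trans (x∧y≤x _ _) x⁻≤x⁻ₖ) x⁻∧d≤z′ ⟩
        x (inject₁ k) ∧ z′          ≤⟨ coverLabel-low b⋖z′ ℓ′ ⟩
        b                           ≤⟨ ⋖⇒≤ b⋖z ⟩
        z                           ∎
        where
        x⁻≤x⁻ₖ : x (inject₁ p) ≤ x (inject₁ k)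
        x⁻≤x⁻ₖ = ≤-trans (⋖⇒≤ (x-covers p)) (x-suc≤x-inject₁ (ℕₚ.<-trans p<i i<k))
      x⁺∧d≰z : ¬ (x (suc p) ∧ d ≤ z)
      x⁺∧d≰z x⁺∧d≤z = x⁺∧d≰z′ (begin
        x (suc p) ∧ d               ≤⟨ ∧-greatest (≤-trans (x∧y≤x _ _) (≤-trans (x-suc≤x-inject₁ p<i) (y≤x∨y b _))) x⁺∧d≤z ⟩
        (b ∨ x (inject₁ i)) ∧ z     ≡⟨ x-leftModular (inject₁ i) b z (⋖⇒≤ b⋖z) ⟩
        b ∨ (x (inject₁ i) ∧ z)     ≤⟨ ∨-least (⋖⇒≤ b⋖z′) (≤-trans (coverLabel-low b⋖z ℓ) (⋖⇒≤ b⋖z′)) ⟩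
        z′                          ∎)
      d≤Mp : d ≤ M p
      d≤Mp = ∨-least (≤-trans (x≤x∨y z _) (proj₁ (threshold⇒M (x≤x∨y z z′) x⁻∧d≤z x⁺∧d≰z)))
                     (≤-trans (x≤x∨y z′ _) (proj₁ A))

  other-upper-cover-below-M : ∀ {b z z′ i k} → b ⋖ z → b ⋖ z′ →
                              CoverLabel b z i → CoverLabel b z′ k → i ≢ k → z′ ≤ M i
  other-upper-cover-below-M {i = i} b⋖z b⋖z′ ℓ ℓ′ i≢k with <-cmp i _
  ... | tri> _ _ k<i = ≤-trans (proj₁ ℓ′)
                         (∨-least (proj₁ (coverLabel-M b⋖z ℓ)) (≤-trans (x-suc≤x-inject₁ k<i) (x≤M i)))
  ... | tri≈ _ i≡k _ = contradiction i≡k i≢k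
  ... | tri< i<k _ _ = upper-cover-with-larger-label-below-M b⋖z b⋖z′ ℓ ℓ′ i<k

  Label? : ∀ y z i → Dec (Label x y z i)
  Label? y z i = (y ∨ (x (suc i) ∧ z) ≟ z) ×-dec all? (λ j → (j <? i) →-dec ¬? (y ∨ (x (suc j) ∧ z) ≟ z))

  Dγ? : ∀ a → Decidable (Dγ x a)
  Dγ? a i = any? (λ y → (y ⋖? a) ×-dec Label? y a i)

  Uγ? : ∀ b → Decidable (Uγ x b)
  Uγ? b i = any? (λ z → (b ⋖? z) ×-dec Label? b z i)

  Independent : (Fin n → Set) → Set
  Independent S = ∀ {i k} → S i → S k → i ≢ k → J i ≤ M k

  Dγ-independent : ∀ a → Independent (Dγ x a)
  Dγ-independent a (y , y⋖a , ℓ) (y′ , y′⋖a , ℓ′) i≢k =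
    ≤-trans (J-below-other-lower-cover y⋖a y′⋖a (Label⇒CoverLabel y⋖a ℓ) ℓ′ᶜ i≢k)
            (proj₁ (coverLabel-M y′⋖a ℓ′ᶜ))
    where ℓ′ᶜ = Label⇒CoverLabel y′⋖a ℓ′

  Uγ-independent : ∀ b → Independent (Uγ x b)
  Uγ-independent b (z , b⋖z , ℓ) (z′ , b⋖z′ , ℓ′) i≢k =
    ≤-trans (proj₁ (coverLabel-J b⋖z ℓᶜ))
            (other-upper-cover-below-M b⋖z′ b⋖z (Label⇒CoverLabel b⋖z′ ℓ′) ℓᶜ (i≢k ∘ sym))
    where ℓᶜ = Label⇒CoverLabel b⋖z ℓ

  Dγ-of-join : ∀ {S a} → Decidable S → Independent S → IsJoinOf S J a → S ≐ Dγ x a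
  Dγ-of-join {S} {a} S? independent (J≤a , a-least) j = mk⇔ (covered j) (labelled j)
    where
    covered : ∀ k → S k → Dγ x a k
    covered k Sk = u , u⋖a , CoverLabel⇒Label u⋖a (subst (CoverLabel u a) l≡k ℓ)
      where
      a≰a∧Mk : ¬ (a ≤ a ∧ M k)
      a≰a∧Mk a≤a∧Mk = J≰M k (≤-trans (J≤a k Sk) (≤-trans a≤a∧Mk (x∧y≤y _ _)))
      lower = lowerCover-above (x∧y≤x a (M k)) a≰a∧Mk
      u = proj₁ lower
      a∧Mk≤u = proj₁ (proj₂ lower)
      u⋖a = proj₂ (proj₂ lower)
      l = proj₁ (coverLabel-exists u⋖a)
      ℓ = proj₂ (coverLabel-exists u⋖a)
      Jk≰u : ¬ (J k ≤ u)
      Jk≰u Jk≤u = ⋖⇒≱ u⋖a (a-least λ i Si → case i ≟ k of λ where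
        (yes i≡k) → subst (λ q → J q ≤ u) (sym i≡k) Jk≤u
        (no  i≢k) → ≤-trans (∧-greatest (J≤a i Si) (independent Si Sk i≢k)) a∧Mk≤u)
      k≤l : k Fin.≤ l
      k≤l = case l <? k of λ where
        (no  l≮k) → ℕₚ.≮⇒≥ l≮k
        (yes l<k) → contradiction (≤-trans (∧-greatest (proj₁ (coverLabel-J u⋖a ℓ)) (J≤M l<k)) a∧Mk≤u)
                                  (proj₂ (coverLabel-J u⋖a ℓ))
      l≡k : l ≡ k
      l≡k = Finₚ.≤-antisym (coverLabel≤ u⋖a ℓ (J≤a k Sk) Jk≰u) k≤l
    labelled : ∀ l → Dγ x a l → S l
    labelled l (u , u⋖a , ℓ) = decidable-stable (S? l) λ ¬Sl → ⋖⇒≱ u⋖a (a-least λ i Si →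
      let (uᵢ , uᵢ⋖a , ℓᵢ) = covered i Si in
      J-below-other-lower-cover uᵢ⋖a u⋖a (Label⇒CoverLabel uᵢ⋖a ℓᵢ) (Label⇒CoverLabel u⋖a ℓ)
                                λ i≡l → ¬Sl (subst S i≡l Si))

  Uγ-of-meet : ∀ {S b} → Decidable S → Independent S → IsMeetOf S M b → S ≐ Uγ x b
  Uγ-of-meet {S} {b} S? independent (b≤M , b-greatest) j = mk⇔ (covered j) (labelled j)
    where
    covered : ∀ k → S k → Uγ x b k
    covered k Sk = z , b⋖z , CoverLabel⇒Label b⋖z (subst (CoverLabel b z) l≡k ℓ)
      where
      b∨Jk≰b : ¬ (b ∨ J k ≤ b)
      b∨Jk≰b b∨Jk≤b = J≰M k (≤-trans (≤-trans (y≤x∨y _ _) b∨Jk≤b) (b≤M k Sk))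
      upper = upperCover-below (x≤x∨y b (J k)) b∨Jk≰b
      z = proj₁ upper
      b⋖z = proj₁ (proj₂ upper)
      z≤b∨Jk = proj₂ (proj₂ upper)
      l = proj₁ (coverLabel-exists b⋖z)
      ℓ = proj₂ (coverLabel-exists b⋖z)
      z≰Mk : ¬ (z ≤ M k)
      z≰Mk z≤Mk = ⋖⇒≱ b⋖z (b-greatest λ i Si → case i ≟ k of λ where
        (yes i≡k) → subst (λ q → z ≤ M q) (sym i≡k) z≤Mk
        (no  i≢k) → ≤-trans z≤b∨Jk (∨-least (b≤M i Si) (independent Sk Si (i≢k ∘ sym))))
      l≤k : l Fin.≤ k
      l≤k = case k <? l of λ where
        (no  k≮l) → ℕₚ.≮⇒≥ k≮l
        (yes k<l) → contradiction (≤-trans z≤b∨Jk (∨-monotonic ≤-refl (≤-trans (J≤x k) (x-suc≤x-inject₁ k<l))))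
                                  (proj₂ ℓ)
      l≡k : l ≡ k
      l≡k = Finₚ.≤-antisym l≤k (≤coverLabel b⋖z ℓ (b≤M k Sk) z≰Mk)
    labelled : ∀ l → Uγ x b l → S l
    labelled l (z , b⋖z , ℓ) = decidable-stable (S? l) λ ¬Sl → ⋖⇒≱ b⋖z (b-greatest λ i Si →
      let (zᵢ , b⋖zᵢ , ℓᵢ) = covered i Si in
      other-upper-cover-below-M b⋖zᵢ b⋖z (Label⇒CoverLabel b⋖zᵢ ℓᵢ) (Label⇒CoverLabel b⋖z ℓ)
                                λ i≡l → ¬Sl (subst S i≡l Si))

  Dγ-is-Uγ : ∀ a → ∃ λ b → Dγ x a ≐ Uγ x b
  Dγ-is-Uγ a with b , meet ← meet-exists xₙ-greatest (Dγ? a) M =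
    b , Uγ-of-meet (Dγ? a) (Dγ-independent a) meet

  Uγ-is-Dγ : ∀ b → ∃ λ a → Uγ x b ≐ Dγ x a
  Uγ-is-Dγ b with a , join ← join-exists x₀-least (Uγ? b) J =
    a , Dγ-of-join (Uγ? b) (Uγ-independent b) join

  Dγ-downward-closed : ∀ a (B : Subset n) → B ⊆ₛ Dγ x a → ∃ λ c → Dγ x c ≐ (λ j → j ∈ B)
  Dγ-downward-closed a B B⊆Dγa with c , join ← join-exists x₀-least (_∈? B) J =
    c , λ j → ⇔-sym (Dγ-of-join (_∈? B) independent join j)
    where
    independent : Independent (_∈ B)
    independent i∈B k∈B = Dγ-independent a (B⊆Dγa _ i∈B) (B⊆Dγa _ k∈B)

proposition5p1 : (L : FiniteLattice) (n : ℕ) (x : Fin (suc n) → FiniteLattice.Elem L) →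
    FiniteLattice.Extremal L n → FiniteLattice.LeftModularChain L n x →
    let open FiniteLattice L in
    ((∀ a → ∃ λ b → Dγ x a ≐ Uγ x b)
    × (∀ b → ∃ λ a → Uγ x b ≐ Dγ x a))
    × (∀ a (B : Subset n) → B ⊆ₛ Dγ x a → ∃ λ c → Dγ x c ≐ (λ j → j ∈ B))
proposition5p1 L n x (_ , joins , meets) chain = (Dγ-is-Uγ , Uγ-is-Dγ) , Dγ-downward-closed
  where open LeftModularLabelling L x joins meets chain
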